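{- Let $m$ be a positive integer and let $\rho \in (0,1)$ be a rational number written as $\rho = \frac{a}{2^v b}$ with $b$ an odd positive integer, $v$ a nonnegative integer, and $a$ an integer with $\gcd(a, 2^v b) = 1$. Then there is a real number $\eta>0$ depending only on $a,b,v,m$ such that for every positive integer $n$ and every integer $N$ which is a sum of at most $m$ powers of two, if $N < \rho \cdot 2^n$ then $N \leq (\rho - \eta)\cdot 2^n$. -}

module Defs where

open import Data.Nat using (ℕ; _^_; _%_)
open import Data.Integer using (+_)
open import Data.Rational using (ℚ; _/_)
open import Data.List using (List; map)
open import Data.Nat.ListAction using (sum)
open import Relation.Binary.PropositionalEquality using (_≡_)

ℕ→ℚ : ℕ → ℚ
ℕ→ℚ n = + n / 1

Odd : ℕ → Set
Odd b = b % 2 ≡ 1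

sumPow2 : List ℕ → ℕ
sumPow2 ks = sum (map (2 ^_) ks)

-- Write ρ = p/q, let N = Σᵢ 2^kᵢ have at most m terms, and put w = qm (so qm < 2^w) and K = mw.
-- Descend through the levels e = n, n − w, …, n − K, moving one exponent kᵢ ≥ e − w per level
-- into a part B of N that stays a multiple of 2^e. Having at most m exponents, at some level all
-- remaining ones are < e − w, and then their sum S obeys 2^(n−K) + Sq ≤ 2^e. As Bq < p2ⁿ are
-- both multiples of 2^e, p2ⁿ − Bq ≥ 2^e, hence p2ⁿ − Nq ≥ 2^(n−K): this is N ≤ (ρ − η)2ⁿ for
-- η = 1/(q2^K). All exponents are shifted up by K to avoid truncated subtraction.
module Submission where

open import Defs

module PowerSums where

  open import Data.Nat
  open import Data.Nat.Properties
  open import Data.Nat.Divisibility using (_∣_; divides; ∣-trans; _∣0; ∣m∣n⇒∣m+n; n∣m*n; m∣m*n)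
  open import Data.Nat.Tactic.RingSolver using (solve-∀)
  open import Data.List using (List; []; _∷_; length; map)
  open import Data.List.Properties using (length-map)
  open import Data.List.Relation.Unary.All using (All; []; _∷_)
  open import Data.Product using (∃₂; _×_; _,_)
  open import Data.Sum using (_⊎_; inj₁; inj₂)
  open import Relation.Nullary using (yes; no)
  open import Relation.Binary.PropositionalEquality

  ^-monoʳ-∣ : ∀ b {m n} → m ≤ n → b ^ m ∣ b ^ n
  ^-monoʳ-∣ b {m} {n} m≤n =
    divides (b ^ (n ∸ m)) (trans (cong (b ^_) (sym (m∸n+n≡m m≤n))) (^-distribˡ-+-* b (n ∸ m) m))

  n<2^n : ∀ n → n < 2 ^ n
  n<2^n zero    = z<s
  n<2^n (suc n) = +-mono-≤-< (^-monoʳ-≤ 2 {0} {n} z≤n) (subst (n <_) (sym (+-identityʳ (2 ^ n))) (n<2^n n))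

  ∣m∣n∧m<n⇒d+m≤n : ∀ {d m n} → d ∣ m → d ∣ n → m < n → d + m ≤ n
  ∣m∣n∧m<n⇒d+m≤n {d} (divides x refl) (divides y refl) xd<yd = *-monoˡ-≤ d (*-cancelʳ-< _ x y xd<yd)

  sumPow2-split : ∀ e ks → All (_< e) ks ⊎
    ∃₂ λ x rest → e ≤ x × sumPow2 ks ≡ 2 ^ x + sumPow2 rest × length ks ≡ suc (length rest)
  sumPow2-split e [] = inj₁ []
  sumPow2-split e (k ∷ ks) with e ≤? k | sumPow2-split e ks
  ... | yes e≤k | _ = inj₂ (k , ks , e≤k , refl , refl)
  ... | no e≰k | inj₁ ks<e = inj₁ (≰⇒> e≰k ∷ ks<e)
  ... | no _   | inj₂ (x , rest , e≤x , ks≡ , len≡) =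
    inj₂ (x , k ∷ rest , e≤x , trans (cong (2 ^ k +_) ks≡) (x+y+z≡y+x+z (2 ^ k) (2 ^ x) _) , cong suc len≡)
    where
    x+y+z≡y+x+z : ∀ a b c → a + (b + c) ≡ b + (a + c)
    x+y+z≡y+x+z = solve-∀

  sumPow2-≤ : ∀ e ks → All (_< e) ks → sumPow2 ks ≤ length ks * 2 ^ e
  sumPow2-≤ e []       []          = z≤n
  sumPow2-≤ e (k ∷ ks) (k<e ∷ ks<e) = +-mono-≤ (^-monoʳ-≤ 2 (<⇒≤ k<e)) (sumPow2-≤ e ks ks<e)

  sumPow2-map-+ : ∀ k ks → sumPow2 (map (k +_) ks) ≡ 2 ^ k * sumPow2 ks
  sumPow2-map-+ k []       = sym (*-zeroʳ (2 ^ k))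
  sumPow2-map-+ k (x ∷ xs) =
    trans (cong₂ _+_ (^-distribˡ-+-* 2 k x) (sumPow2-map-+ k xs)) (sym (*-distribˡ-+ (2 ^ k) (2 ^ x) _))

  module _ {q w : ℕ} where
    open ≤-Reasoning

    sumPow2-below-level : ∀ j f ks → length ks ≤ suc j → q * suc j < 2 ^ w →
      All (_< j * w + f) ks → 2 ^ f + sumPow2 ks * q ≤ 2 ^ (suc j * w + f)
    sumPow2-below-level j f ks len≤ qj<2^w ks<e = begin
      2 ^ f + sumPow2 ks * q        ≤⟨ +-mono-≤ (^-monoʳ-≤ 2 (m≤n+m f (j * w))) (*-monoˡ-≤ q S≤) ⟩
      2 ^ e + (suc j * 2 ^ e) * q   ≡⟨ factor (2 ^ e) (suc j) q ⟩
      2 ^ e * suc (q * suc j)       ≤⟨ *-monoʳ-≤ (2 ^ e) qj<2^w ⟩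
      2 ^ e * 2 ^ w                 ≡⟨ ^-distribˡ-+-* 2 e w ⟨
      2 ^ (e + w)                   ≡⟨ cong (2 ^_) (regroup j w f) ⟩
      2 ^ (suc j * w + f)           ∎
      where
      e : ℕ
      e = j * w + f
      S≤ : sumPow2 ks ≤ suc j * 2 ^ e
      S≤ = ≤-trans (sumPow2-≤ e ks ks<e) (*-monoˡ-≤ (2 ^ e) len≤)
      factor : ∀ E a q → E + (a * E) * q ≡ E * (1 + q * a)
      factor = solve-∀
      regroup : ∀ j w f → (j * w + f) + w ≡ (w + j * w) + f
      regroup = solve-∀

    sumPow2-gap : ∀ j f B T ks → length ks ≤ j → q * j < 2 ^ w →
      2 ^ (j * w + f) ∣ B → 2 ^ (j * w + f) ∣ T →
      (B + sumPow2 ks) * q < T → 2 ^ f + (B + sumPow2 ks) * q ≤ T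
    sumPow2-gap zero f B T [] _ _ 2^f∣B 2^f∣T Bq<T =
      ∣m∣n∧m<n⇒d+m≤n (∣-trans (∣m∣n⇒∣m+n 2^f∣B (_ ∣0)) (m∣m*n q)) 2^f∣T Bq<T
    sumPow2-gap (suc j) f B T ks len≤ qj<2^w 2^E∣B 2^E∣T [B+S]q<T with sumPow2-split (j * w + f) ks
    ... | inj₂ (x , rest , e≤x , ks≡ , len≡) =
      subst (λ S → 2 ^ f + S * q ≤ T) (sym moved)
        (sumPow2-gap j f (B + 2 ^ x) T rest
          (≤-pred (subst (_≤ suc j) len≡ len≤))
          (≤-<-trans (*-monoʳ-≤ q (n≤1+n j)) qj<2^w)
          (∣m∣n⇒∣m+n (∣-trans 2^e∣2^E 2^E∣B) (^-monoʳ-∣ 2 e≤x))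
          (∣-trans 2^e∣2^E 2^E∣T)
          (subst (λ S → S * q < T) moved [B+S]q<T))
      where
      moved : B + sumPow2 ks ≡ B + 2 ^ x + sumPow2 rest
      moved = trans (cong (B +_) ks≡) (sym (+-assoc B (2 ^ x) (sumPow2 rest)))
      2^e∣2^E : 2 ^ (j * w + f) ∣ 2 ^ (suc j * w + f)
      2^e∣2^E = ^-monoʳ-∣ 2 (+-monoˡ-≤ f (m≤n+m (j * w) w))
    ... | inj₁ ks<e = begin
      2 ^ f + (B + S) * q        ≡⟨ regroup (2 ^ f) B S q ⟩
      (2 ^ f + S * q) + B * q    ≤⟨ +-monoˡ-≤ (B * q) (sumPow2-below-level j f ks len≤ qj<2^w ks<e) ⟩
      2 ^ (suc j * w + f) + B * q ≤⟨ ∣m∣n∧m<n⇒d+m≤n (∣-trans 2^E∣B (m∣m*n q)) 2^E∣T Bq<T ⟩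
      T                          ∎
      where
      S : ℕ
      S = sumPow2 ks
      Bq<T : B * q < T
      Bq<T = ≤-<-trans (*-monoˡ-≤ q (m≤m+n B S)) [B+S]q<T
      regroup : ∀ F B S q → F + (B + S) * q ≡ (F + S * q) + B * q
      regroup = solve-∀

  sumPow2-gap-scaled : ∀ m q p n ks → length ks ≤ m → sumPow2 ks * q < p * 2 ^ n →
    let Q = q * 2 ^ (m * (q * m)) in sumPow2 ks * (q * Q) + q * 2 ^ n ≤ p * Q * 2 ^ n
  sumPow2-gap-scaled m q p n ks len≤ Nq<pX =
    subst₂ _≤_ (left-side q (2 ^ n) (2 ^ K) N) (right-side q p (2 ^ K) (2 ^ n))
      (*-monoʳ-≤ q (subst₂ _≤_ (cong (2 ^ n +_) shifted-sum) shifted-bound shifted-gap))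
    where
    K N : ℕ
    K = m * (q * m)
    N = sumPow2 ks
    shifted-sum : sumPow2 (map (K +_) ks) * q ≡ 2 ^ K * (N * q)
    shifted-sum = trans (cong (_* q) (sumPow2-map-+ K ks)) (*-assoc (2 ^ K) N q)
    shifted-bound : p * 2 ^ (K + n) ≡ 2 ^ K * (p * 2 ^ n)
    shifted-bound = trans (cong (p *_) (^-distribˡ-+-* 2 K n)) (x*[y*z]≡y*[x*z] p (2 ^ K) (2 ^ n))
      where
      x*[y*z]≡y*[x*z] : ∀ x y z → x * (y * z) ≡ y * (x * z)
      x*[y*z]≡y*[x*z] = solve-∀
    shifted-gap : 2 ^ n + sumPow2 (map (K +_) ks) * q ≤ p * 2 ^ (K + n)
    shifted-gap = sumPow2-gap m n 0 (p * 2 ^ (K + n)) (map (K +_) ks)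
      (subst (_≤ m) (sym (length-map (K +_) ks)) len≤)
      (n<2^n (q * m))
      (_ ∣0)
      (n∣m*n p)
      (subst₂ _<_ (sym shifted-sum) (sym shifted-bound) (*-monoʳ-< (2 ^ K) {{m^n≢0 2 K}} Nq<pX))
    left-side : ∀ q X A N → q * (X + A * (N * q)) ≡ N * (q * (q * A)) + q * X
    left-side = solve-∀
    right-side : ∀ q p A X → q * (A * (p * X)) ≡ p * (q * A) * X
    right-side = solve-∀

module CrossMultiplication where

  open import Data.Nat as ℕ using (ℕ; suc; NonZero)
  import Data.Nat.Properties as ℕ
  open import Data.Nat.Coprimality using (Coprime)
  open import Data.Integer as ℤ using (+_; -1ℤ)
  import Data.Integer.Properties as ℤ
  open import Data.Integer.Tactic.RingSolver using (solve-∀)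
  open import Data.Rational using (ℚ; mkℚ; toℚᵘ; _/_; _<_; _≤_; _*_; _-_; -_)
  open import Data.Rational.Properties
    using (toℚᵘ-fromℚᵘ; toℚᵘ-mono-<; toℚᵘ-cancel-≤; toℚᵘ-homo-*; toℚᵘ-homo-+; toℚᵘ-homo‿-)
  open import Data.Rational.Unnormalised as ℚᵘ using (mkℚᵘ; *<*; *≤*) renaming (_≃_ to _≃ᵘ_)
  import Data.Rational.Unnormalised.Properties as ℚᵘ
  open import Relation.Binary.PropositionalEquality

  toℚᵘ-ℕ→ℚ : ∀ n → toℚᵘ (ℕ→ℚ n) ≃ᵘ mkℚᵘ (+ n) 0
  toℚᵘ-ℕ→ℚ n = toℚᵘ-fromℚᵘ (mkℚᵘ (+ n) 0)

  module _ {p d : ℕ} .{c : Coprime p (suc d)} where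

    private
      ρ : ℚ
      ρ = mkℚ (+ p) d c
      q : ℕ
      q = suc d

    ℕ→ℚ<ρ*ℕ→ℚ⇒*<* : ∀ N X → ℕ→ℚ N < ρ * ℕ→ℚ X → N ℕ.* q ℕ.< p ℕ.* X
    ℕ→ℚ<ρ*ℕ→ℚ⇒*<* N X N<ρX with ℚᵘ.<-respʳ-≃ toℚᵘ-ρX (ℚᵘ.<-respˡ-≃ (toℚᵘ-ℕ→ℚ N) (toℚᵘ-mono-< N<ρX))
      where
      toℚᵘ-ρX : toℚᵘ (ρ * ℕ→ℚ X) ≃ᵘ toℚᵘ ρ ℚᵘ.* mkℚᵘ (+ X) 0
      toℚᵘ-ρX = ℚᵘ.≃-trans (toℚᵘ-homo-* ρ (ℕ→ℚ X)) (ℚᵘ.*-congˡ {toℚᵘ ρ} (toℚᵘ-ℕ→ℚ X))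
    ... | *<* Nq<pX = ℤ.drop‿+<+ (subst₂ ℤ._<_ lhs rhs Nq<pX)
      where
      lhs : + N ℤ.* + (q ℕ.* 1) ≡ + (N ℕ.* q)
      lhs = trans (sym (ℤ.pos-* N (q ℕ.* 1))) (cong (λ k → + (N ℕ.* k)) (ℕ.*-identityʳ q))
      rhs : (+ p ℤ.* + X) ℤ.* + 1 ≡ + (p ℕ.* X)
      rhs = trans (ℤ.*-identityʳ _) (sym (ℤ.pos-* p X))

    *≤*⇒ℕ→ℚ≤[ρ-1/Q]*ℕ→ℚ : ∀ N X Q .{{_ : NonZero Q}} → N ℕ.* (q ℕ.* Q) ℕ.+ q ℕ.* X ℕ.≤ p ℕ.* Q ℕ.* X →
      ℕ→ℚ N ≤ (ρ - + 1 / Q) * ℕ→ℚ X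
    *≤*⇒ℕ→ℚ≤[ρ-1/Q]*ℕ→ℚ N X Q@(suc D) h =
      toℚᵘ-cancel-≤ (ℚᵘ.≤-respʳ-≃ (ℚᵘ.≃-sym toℚᵘ-RHS) (ℚᵘ.≤-respˡ-≃ (ℚᵘ.≃-sym (toℚᵘ-ℕ→ℚ N))
        (*≤* (subst₂ ℤ._≤_ lhs rhs (ℤ.+≤+ (ℕ.m+n≤o⇒m≤o∸n (N ℕ.* (q ℕ.* Q)) {q ℕ.* X} h))))))
      where
      η : ℚ
      η = + 1 / Q
      toℚᵘ-RHS : toℚᵘ ((ρ - η) * ℕ→ℚ X) ≃ᵘ (toℚᵘ ρ ℚᵘ.- mkℚᵘ (+ 1) D) ℚᵘ.* mkℚᵘ (+ X) 0
      toℚᵘ-RHS = ℚᵘ.≃-trans (toℚᵘ-homo-* (ρ - η) (ℕ→ℚ X))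
        (ℚᵘ.*-cong (ℚᵘ.≃-trans (toℚᵘ-homo-+ ρ (- η))
          (ℚᵘ.+-congʳ (toℚᵘ ρ) (ℚᵘ.≃-trans (toℚᵘ-homo‿- η) (ℚᵘ.-‿cong (toℚᵘ-fromℚᵘ (mkℚᵘ (+ 1) D))))))
          (toℚᵘ-ℕ→ℚ X))
      lhs : + (N ℕ.* (q ℕ.* Q)) ≡ + N ℤ.* + (q ℕ.* Q ℕ.* 1)
      lhs = trans (cong (λ k → + (N ℕ.* k)) (sym (ℕ.*-identityʳ (q ℕ.* Q)))) (ℤ.pos-* N _)
      qX≤pQX : q ℕ.* X ℕ.≤ p ℕ.* Q ℕ.* X
      qX≤pQX = ℕ.≤-trans (ℕ.m≤n+m (q ℕ.* X) (N ℕ.* (q ℕ.* Q))) h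
      distrib : ∀ P Q X q → P ℤ.* Q ℤ.* X ℤ.- q ℤ.* X ≡ ((P ℤ.* Q ℤ.+ -1ℤ ℤ.* q) ℤ.* X) ℤ.* + 1
      distrib = solve-∀
      rhs : + (p ℕ.* Q ℕ.* X ℕ.∸ q ℕ.* X) ≡ ((+ p ℤ.* + Q ℤ.+ -1ℤ ℤ.* + q) ℤ.* + X) ℤ.* + 1
      rhs = begin
        + (p ℕ.* Q ℕ.* X ℕ.∸ q ℕ.* X)    ≡⟨ ℤ.⊖-≥ qX≤pQX ⟨
        p ℕ.* Q ℕ.* X ℤ.⊖ q ℕ.* X        ≡⟨ ℤ.[+m]-[+n]≡m⊖n (p ℕ.* Q ℕ.* X) (q ℕ.* X) ⟨
        + (p ℕ.* Q ℕ.* X) ℤ.- + (q ℕ.* X) ≡⟨ cong₂ ℤ._-_ (trans (ℤ.pos-* (p ℕ.* Q) X) (cong (ℤ._* + X) (ℤ.pos-* p Q))) (ℤ.pos-* q X) ⟩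
        + p ℤ.* + Q ℤ.* + X ℤ.- + q ℤ.* + X ≡⟨ distrib (+ p) (+ Q) (+ X) (+ q) ⟩
        ((+ p ℤ.* + Q ℤ.+ -1ℤ ℤ.* + q) ℤ.* + X) ℤ.* + 1 ∎
        where open ≡-Reasoning

open import Data.Nat using (ℕ; _^_; _≤_; _>_; suc; NonZero)
open import Data.Integer using (ℤ; ∣_∣; +_; -[1+_])
open import Data.Rational using (ℚ; ↥_; ↧ₙ_; 0ℚ; 1ℚ; _<_; _*_; _-_; mkℚ; *<*; _/_) renaming (_≤_ to _≤ℚ_)
open import Data.Rational.Properties using (positive⁻¹; normalize-pos)
open import Data.Nat.Properties using (m*n≢0; m^n≢0)
open import Data.Nat.Coprimality using (Coprime)
open import Data.List using (List; length)
open import Data.Product using (∃; _×_; _,_)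
open import Relation.Binary.PropositionalEquality using (_≡_)

open PowerSums using (sumPow2-gap-scaled)
open CrossMultiplication using (ℕ→ℚ<ρ*ℕ→ℚ⇒*<*; *≤*⇒ℕ→ℚ≤[ρ-1/Q]*ℕ→ℚ)

lemma4p6 : (m : ℕ) (a : ℤ) (b v : ℕ) (ρ : ℚ) →
    m > 0 → b > 0 → Odd b → Coprime ∣ a ∣ (2 ^ v Data.Nat.* b) →
    ↥ ρ ≡ a → ↧ₙ ρ ≡ 2 ^ v Data.Nat.* b →
    0ℚ < ρ → ρ < 1ℚ →
    ∃ λ (η : ℚ) → 0ℚ < η ×
      ((n : ℕ) → n > 0 → (ks : List ℕ) → length ks ≤ m →
        ℕ→ℚ (sumPow2 ks) < ρ * ℕ→ℚ (2 ^ n) →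
        ℕ→ℚ (sumPow2 ks) ≤ℚ (ρ - η) * ℕ→ℚ (2 ^ n))
lemma4p6 _ _ _ _ (mkℚ -[1+ _ ] _ _) _ _ _ _ _ _ (*<* ()) _
lemma4p6 m _ _ _ ρ@(mkℚ (+ p) d _) _ _ _ _ _ _ _ _ =
  + 1 / Q , positive⁻¹ (+ 1 / Q) {{normalize-pos 1 Q}} , gap
  where
  q K Q : ℕ
  q = suc d
  K = m Data.Nat.* (q Data.Nat.* m)
  Q = q Data.Nat.* 2 ^ K
  instance
    Q≢0 : NonZero Q
    Q≢0 = m*n≢0 q (2 ^ K) {{_}} {{m^n≢0 2 K}}
  gap : (n : ℕ) → n > 0 → (ks : List ℕ) → length ks ≤ m →
    ℕ→ℚ (sumPow2 ks) < ρ * ℕ→ℚ (2 ^ n) →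
    ℕ→ℚ (sumPow2 ks) ≤ℚ (ρ - + 1 / Q) * ℕ→ℚ (2 ^ n)
  gap n _ ks len≤ N<ρX = *≤*⇒ℕ→ℚ≤[ρ-1/Q]*ℕ→ℚ (sumPow2 ks) (2 ^ n) Q
    (sumPow2-gap-scaled m q p n ks len≤ (ℕ→ℚ<ρ*ℕ→ℚ⇒*<* (sumPow2 ks) (2 ^ n) N<ρX))
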